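{- Let $G$ and $H$ be connected graphs with $n(G)\ge n(H)$. Then $$\max\{\Delta(G)n(H),\ \Delta(H)n(G)\}\le\mathrm{vv}(G\,\square\,H)\le (n(G)-1)\,n(H).$$ Both bounds are sharp; in particular $\mathrm{vv}(K_m\,\square\,K_n)=mn-n$ for $m\ge n\ge 2$.
   Context: All graphs are finite and simple; $n(\cdot)$ denotes order and $\Delta(\cdot)$ maximum degree. The Cartesian product $G\,\square\,H$ has vertex set $V(G)\times V(H)$, with $(g,h)$ adjacent to $(g',h')$ iff either $gg'\in E(G)$ and $h=h'$, or $g=g'$ and $hh'\in E(H)$. For $x\in V(X)$, a set $S\subseteq V(X)\setminus\{x\}$ is an $x$-visibility set of $X$ if for every $y\in S$ there exists a shortest $x,y$-path $P$ with $V(P)\cap S=\{y\}$; $v_x(X)$ is the maximum size of an $x$-visibility set and $\mathrm{vv}(X)=\max_{x\in V(X)} v_x(X)$. -}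

module Defs where

open import Data.Nat using (ℕ; zero; suc; _+_; _*_; _∸_; _⊔_; _≤_)
open import Data.Fin using (Fin; _≟_; remQuot)
open import Data.Fin.Subset using (Subset; _∈_; _∉_; ∣_∣)
open import Data.List using (List; []; _∷_; length; filter; map; foldr; allFin)
open import Data.List.Relation.Unary.Any using (Any)
open import Data.Product using (Σ; _×_; _,_; proj₁; proj₂; ∃-syntax)
open import Data.Sum using (_⊎_; inj₁; inj₂)
open import Data.Empty using (⊥)
open import Relation.Nullary using (¬_; Dec; yes; no)
open import Relation.Nullary.Decidable using (¬?; _×-dec_; _⊎-dec_)
open import Relation.Binary using (Decidable)
open import Relation.Binary.PropositionalEquality using (_≡_; refl; sym)

record Graph : Set₁ where
  field
    n      : ℕ
    Adj    : Fin n → Fin n → Set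
    adj?   : Decidable Adj
    symm   : ∀ {u v} → Adj u v → Adj v u
    irrefl : ∀ {u} → ¬ Adj u u
open Graph public

module _ (G : Graph) where

  data Walk : Fin (n G) → Fin (n G) → Set where
    []  : ∀ {x} → Walk x x
    _∷_ : ∀ {x y z} → Adj G x y → Walk y z → Walk x z

  walkLength : ∀ {x y} → Walk x y → ℕ
  walkLength []      = 0
  walkLength (_ ∷ p) = suc (walkLength p)

  walkVertices : ∀ {x y} → Walk x y → List (Fin (n G))
  walkVertices {x} []      = x ∷ []
  walkVertices {x} (_ ∷ p) = x ∷ walkVertices p

  -- a shortest x,y-path (a shortest walk is necessarily a path)
  IsShortest : ∀ {x y} → Walk x y → Set
  IsShortest {x} {y} p = ∀ (q : Walk x y) → walkLength p ≤ walkLength q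

  Connected : Set
  Connected = (1 ≤ n G) × (∀ x y → Walk x y)

  degree : Fin (n G) → ℕ
  degree v = length (filter (adj? G v) (allFin (n G)))

  -- maximum degree (0 for the empty graph)
  Δ : ℕ
  Δ = foldr _⊔_ 0 (map degree (allFin (n G)))

  IsVisibilitySet : Fin (n G) → Subset (n G) → Set
  IsVisibilitySet x S =
    x ∉ S ×
    (∀ y → y ∈ S → Σ (Walk x y) λ P →
       IsShortest P × (∀ z → Any (z ≡_) (walkVertices P) → z ∈ S → z ≡ y))

  IsVV : ℕ → Set
  IsVV k = (∃[ x ] ∃[ S ] (IsVisibilitySet x S × ∣ S ∣ ≡ k))
         × (∀ x S → IsVisibilitySet x S → ∣ S ∣ ≤ k)

-- Cartesian product; vertex (g,h) is encoded as the element i of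
-- Fin (n G * n H) with remQuot (n H) i = (g , h).
_□_ : Graph → Graph → Graph
G □ H = record
  { n = n G * n H
  ; Adj = PAdj
  ; adj? = PAdj?
  ; symm = Psym
  ; irrefl = Pirr
  }
  where
  fstC : Fin (n G * n H) → Fin (n G)
  fstC i = proj₁ (remQuot {n G} (n H) i)
  sndC : Fin (n G * n H) → Fin (n H)
  sndC i = proj₂ (remQuot {n G} (n H) i)
  PAdj : Fin (n G * n H) → Fin (n G * n H) → Set
  PAdj i j = (Adj G (fstC i) (fstC j) × sndC i ≡ sndC j)
           ⊎ (fstC i ≡ fstC j × Adj H (sndC i) (sndC j))
  PAdj? : Decidable PAdj
  PAdj? i j = (adj? G (fstC i) (fstC j) ×-dec (sndC i ≟ sndC j))
          ⊎-dec ((fstC i ≟ fstC j) ×-dec adj? H (sndC i) (sndC j))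
  Psym : ∀ {i j} → PAdj i j → PAdj j i
  Psym (inj₁ (a , e)) = inj₁ (symm G a , sym e)
  Psym (inj₂ (e , a)) = inj₂ (sym e , symm H a)
  Pirr : ∀ {i} → ¬ PAdj i i
  Pirr (inj₁ (a , _)) = irrefl G a
  Pirr (inj₂ (_ , a)) = irrefl H a

K : ℕ → Graph
K m = record
  { n = m
  ; Adj = λ i j → ¬ (i ≡ j)
  ; adj? = λ i j → ¬? (i ≟ j)
  ; symm = λ ne e → ne (sym e)
  ; irrefl = λ ne → ne refl
  }

-- Write vertices of G □ H as pairs (g , h).  Every walk projects to a walk in G and one in H
-- whose lengths add up to its own.  Lower bound: the vertices whose G-coordinate is adjacent to g
-- form a (g , h)-visibility set of size deg(g)·n(H); a vertex (g′ , h′) of it is reached by a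
-- shortest walk from h to h′ inside the copy of H at g, which avoids the set, followed by one
-- G-edge, and by the projections no walk is shorter.  Symmetrically for H.  Upper bound: an
-- x-visibility set S misses at least n(H) vertices.  Either every row {(g , h) | g} meets the
-- complement of S, or a whole row lies in S; then the visibility path to each (g , h) of that row
-- enters it along an H-edge from a vertex outside S, giving one missed vertex in every column,
-- n(G) ≥ n(H) in all.  Visibility is decidable in connected graphs, so vv exists.

module Submission where

open import Defs
open import Data.Nat using (ℕ; zero; suc; _+_; _*_; _∸_; _⊔_; _≤_; z≤n; s≤s; _≟_)
open import Data.Nat.Properties
  using ( ≤-trans; ≤-reflexive; ≤-antisym; ≮⇒≥; suc-injective; +-comm; +-suc; *-comm; +-mono-≤
        ; *-mono-≤; *-monoˡ-≤; *-identityˡ; *-distribʳ-∸; ⊔-sel; ⊔-lub; ∸-monoʳ-≤; m∸[m∸n]≡n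
        ; m≤n+m∸n; m+n≤o⇒m≤o∸n; m≤o∸n⇒m+n≤o )
open import Data.Fin using (Fin; zero; suc; toℕ; fromℕ; fromℕ<; combine; remQuot)
  renaming (_≟_ to _≟ᶠ_)
import Data.Fin.Properties as Fin
open import Data.Fin.Properties
  using (any?; all?; ¬∀⟶∃¬; ¬∀⟶∃¬-smallest; toℕ-fromℕ; toℕ-fromℕ<; toℕ-inject
        ; remQuot-combine; combine-remQuot; *↔×)
open import Data.Fin.Subset using (Subset; _∈_; _∉_; ∣_∣; ⊥; ∁; _-_)
open import Data.Fin.Subset.Properties
  using (_∈?_; ∉⊥; ∣⊥∣≡0; ∣p∣≤n; ∣∁p∣≡n∸∣p∣; anySubset?; x∉p⇒x∈∁p; x∈p⇒∣p-x∣<∣p∣; x∈p∧x≢y⇒x∈p-y)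
open import Data.List using (List; []; _∷_; length; lookup; filter; map; allFin)
open import Data.List.Properties using (filter-all; length-tabulate)
open import Data.List.Relation.Unary.All as All using ()
open import Data.List.Relation.Unary.AllPairs using ([]; _∷_)
open import Data.List.Relation.Unary.Any using (Any; here; there)
open import Data.List.Relation.Unary.Unique.Propositional using (Unique)
open import Data.List.Relation.Unary.Unique.Propositional.Properties using (filter⁺; allFin⁺)
open import Data.List.Membership.Propositional.Properties
  using (∈-lookup; ∈-filter⁻; ∈-map⁻; foldr-selective)
open import Data.Vec using (tabulate)
open import Data.Vec.Properties using (lookup∘tabulate; []=⇒lookup; lookup⇒[]=)
open import Data.Product using (Σ; _×_; _,_; proj₁; proj₂; ∃-syntax)
open import Data.Product.Function.NonDependent.Propositional using (_×-↣_)
open import Data.Sum using (_⊎_; inj₁; inj₂)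
open import Data.Unit using (tt)
open import Data.Empty using (⊥-elim)
open import Function using (id; _∘_; _↣_; mk↣; Injection)
open import Function.Definitions using (Injective)
open import Function.Construct.Composition using (_↣-∘_)
open import Function.Construct.Identity using (↣-id)
open import Function.Properties.Inverse using (↔⇒↣; ↔-sym)
open import Relation.Nullary using (¬_; Dec; yes; no; does)
open import Relation.Nullary.Decidable
  using (¬?; _×-dec_; _→-dec_; map′; decidable-stable; dec-true)
open import Relation.Unary using (Decidable)
open import Relation.Unary.Properties using (U?)
open import Relation.Binary.PropositionalEquality
  using (_≡_; _≢_; refl; sym; trans; cong; subst; subst₂; module ≡-Reasoning)

least : ∀ {P : ℕ → Set} → Decidable P → ∀ {m} → P m → ∃[ d ] P d × (∀ {k} → P k → d ≤ k)
least {P} P? {m} pm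
  with i , ¬¬Pi , ¬P-below ← ¬∀⟶∃¬-smallest (suc m) (¬_ ∘ P ∘ toℕ) (¬? ∘ P? ∘ toℕ)
                                (λ ¬P → ¬P (fromℕ m) (subst P (sym (toℕ-fromℕ m)) pm))
  = toℕ i , decidable-stable (P? (toℕ i)) ¬¬Pi , minimal
  where
  minimal : ∀ {k} → P k → toℕ i ≤ k
  minimal pk = ≮⇒≥ λ k<i →
    ¬P-below (fromℕ< k<i) (subst P (sym (trans (toℕ-inject (fromℕ< k<i)) (toℕ-fromℕ< k<i))) pk)

-- The largest witness below b is b ∸ d for the least d with P (b ∸ d).
greatest : ∀ {P : ℕ → Set} → Decidable P → ∀ {a b} → P a → (∀ {k} → P k → k ≤ b) →
           ∃[ d ] P d × (∀ {k} → P k → k ≤ d)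
greatest {P} P? {a} {b} pa bounded =
  let d , pd , minimal = least (P? ∘ (b ∸_)) {b ∸ a} (reflect pa)
  in b ∸ d , pd , λ {k} pk →
       subst (_≤ b ∸ d) (m∸[m∸n]≡n (bounded pk)) (∸-monoʳ-≤ b (minimal {b ∸ k} (reflect pk)))
  where
  reflect : ∀ {k} → P k → P (b ∸ (b ∸ k))
  reflect pk = subst P (sym (m∸[m∸n]≡n (bounded pk))) pk

module _ {N} {P : Fin N → Set} (P? : Decidable P) where

  subset : Subset N
  subset = tabulate (does ∘ P?)

  ∈-subset⁺ : ∀ {i} → P i → i ∈ subset
  ∈-subset⁺ {i} Pi = lookup⇒[]= i subset (trans (lookup∘tabulate _ i) (dec-true (P? i) Pi))

  -- In the absent no-case the second equation reads false ≡ true.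
  ∈-subset⁻ : ∀ {i} → i ∈ subset → P i
  ∈-subset⁻ {i} i∈ with P? i | trans (sym (lookup∘tabulate (does ∘ P?) i)) ([]=⇒lookup i∈)
  ... | yes Pi | _ = Pi

injective⇒≤∣p∣ : ∀ {m N} {f : Fin m → Fin N} → Injective _≡_ _≡_ f →
                 ∀ {p} → (∀ i → f i ∈ p) → m ≤ ∣ p ∣
injective⇒≤∣p∣ {zero}  _ _ = z≤n
injective⇒≤∣p∣ {suc m} {f = f} inj {p} f∈p =
  ≤-trans (s≤s (injective⇒≤∣p∣ (Fin.suc-injective ∘ inj) {p - f zero} f-suc∈))
          (x∈p⇒∣p-x∣<∣p∣ (f∈p zero))
  where
  f-suc∈ : ∀ i → f (suc i) ∈ p - f zero
  f-suc∈ i = x∈p∧x≢y⇒x∈p-y (f∈p (suc i)) (λ e → Fin.0≢1+n (sym (inj e)))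

left-inverse⇒≤∣p∣ : ∀ {m N} (f : Fin m → Fin N) (f⁻¹ : Fin N → Fin m) → (∀ i → f⁻¹ (f i) ≡ i) →
                    ∀ {p} → (∀ i → f i ∈ p) → m ≤ ∣ p ∣
left-inverse⇒≤∣p∣ f f⁻¹ inverse = injective⇒≤∣p∣ λ {i} {j} fi≡fj →
  trans (sym (inverse i)) (trans (cong f⁻¹ fi≡fj) (inverse j))

↣⇒≤∣p∣ : ∀ {m N} (f : Fin m ↣ Fin N) {p} → (∀ i → Injection.to f i ∈ p) → m ≤ ∣ p ∣
↣⇒≤∣p∣ f = injective⇒≤∣p∣ (Injection.injective f)

≤∣∁p∣⇒∣p∣≤n∸ : ∀ {N k} (p : Subset N) → k ≤ ∣ ∁ p ∣ → ∣ p ∣ ≤ N ∸ k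
≤∣∁p∣⇒∣p∣≤n∸ {N} {k} p k≤∣∁p∣ =
  m+n≤o⇒m≤o∸n ∣ p ∣ (subst (_≤ N) (+-comm k ∣ p ∣)
    (m≤o∸n⇒m+n≤o k (∣p∣≤n p) (subst (k ≤_) (∣∁p∣≡n∸∣p∣ p) k≤∣∁p∣)))

[m∸1]*n≡m*n∸n : ∀ m n → (m ∸ 1) * n ≡ m * n ∸ n
[m∸1]*n≡m*n∸n m n = trans (*-distribʳ-∸ n m 1) (cong (m * n ∸_) (*-identityˡ n))

combine-↣ : ∀ {a b c d} → Fin a ↣ Fin c → Fin b ↣ Fin d → Fin (a * b) ↣ Fin (c * d)
combine-↣ f g = ↔⇒↣ (↔-sym *↔×) ↣-∘ ((f ×-↣ g) ↣-∘ ↔⇒↣ *↔×)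

lookup-injective : ∀ {A : Set} {xs : List A} → Unique xs → Injective _≡_ _≡_ (lookup xs)
lookup-injective (_   ∷ _)  {zero}  {zero}  _ = refl
lookup-injective (x∉ ∷ _)  {zero}  {suc j} e = ⊥-elim (All.lookup x∉ (∈-lookup j) e)
lookup-injective (x∉ ∷ _)  {suc i} {zero}  e = ⊥-elim (All.lookup x∉ (∈-lookup i) (sym e))
lookup-injective (_   ∷ u) {suc i} {suc j} e = cong suc (lookup-injective u e)

module _ (X : Graph) where

  neighbour : ∀ v → Fin (degree X v) ↣ Fin (n X)
  neighbour v = mk↣ (lookup-injective (filter⁺ (adj? X v) (allFin⁺ (n X))))

  neighbour-adjacent : ∀ v i → Adj X v (Injection.to (neighbour v) i)
  neighbour-adjacent v i = proj₂ (∈-filter⁻ (adj? X v) {xs = allFin (n X)} (∈-lookup i))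

  Δ-attained : Δ X ≡ 0 ⊎ ∃[ v ] Δ X ≡ degree X v
  Δ-attained with foldr-selective ⊔-sel 0 (map (degree X) (allFin (n X)))
  ... | inj₁ Δ≡0 = inj₁ Δ≡0
  ... | inj₂ Δ∈  = let v , _ , Δ≡ = ∈-map⁻ (degree X) Δ∈ in inj₂ (v , Δ≡)

module _ {X : Graph} where

  private variable u v w u′ v′ z : Fin (n X)

  infix 4 _∈ʷ_
  _∈ʷ_ : Fin (n X) → Walk X u v → Set
  z ∈ʷ p = Any (z ≡_) (walkVertices X p)

  AllVertices : (Fin (n X) → Set) → Walk X u v → Set
  AllVertices R p = ∀ z → z ∈ʷ p → R z

  Unblocked : Subset (n X) → Walk X u v → Set
  Unblocked {v = v} S = AllVertices (λ z → z ∈ S → z ≡ v)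

  start∈ʷ : (p : Walk X u v) → u ∈ʷ p
  start∈ʷ []      = here refl
  start∈ʷ (_ ∷ _) = here refl

  infixr 5 _++ʷ_
  _++ʷ_ : Walk X u v → Walk X v w → Walk X u w
  []      ++ʷ q = q
  (e ∷ p) ++ʷ q = e ∷ (p ++ʷ q)

  length-++ʷ : (p : Walk X u v) (q : Walk X v w) →
               walkLength X (p ++ʷ q) ≡ walkLength X p + walkLength X q
  length-++ʷ []      q = refl
  length-++ʷ (e ∷ p) q = cong suc (length-++ʷ p q)

  ∈ʷ-++⁻ : (p : Walk X u v) (q : Walk X v w) → z ∈ʷ p ++ʷ q → z ∈ʷ p ⊎ z ∈ʷ q
  ∈ʷ-++⁻ []      q t         = inj₂ t
  ∈ʷ-++⁻ (e ∷ p) q (here r)  = inj₁ (here r)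
  ∈ʷ-++⁻ (e ∷ p) q (there t) with ∈ʷ-++⁻ p q t
  ... | inj₁ t′ = inj₁ (there t′)
  ... | inj₂ t′ = inj₂ t′

  cast : u ≡ u′ → v ≡ v′ → Walk X u v → Walk X u′ v′
  cast refl refl p = p

  length-cast : (eu : u ≡ u′) (ev : v ≡ v′) (p : Walk X u v) →
                walkLength X (cast eu ev p) ≡ walkLength X p
  length-cast refl refl p = refl

  ∈ʷ-cast⁻ : (eu : u ≡ u′) (ev : v ≡ v′) (p : Walk X u v) → z ∈ʷ cast eu ev p → z ∈ʷ p
  ∈ʷ-cast⁻ refl refl p t = t

  ≢⇒1≤length : u ≢ v → (p : Walk X u v) → 1 ≤ walkLength X p
  ≢⇒1≤length u≢u [] = ⊥-elim (u≢u refl)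
  ≢⇒1≤length _ (_ ∷ _) = s≤s z≤n

  crossing-edge : {R : Fin (n X) → Set} → Decidable R → (p : Walk X u v) → ¬ R u → R v →
                  ∃[ a ] ∃[ b ] Adj X a b × a ∈ʷ p × b ∈ʷ p × ¬ R a × R b
  crossing-edge R? [] ¬Ru Rv = ⊥-elim (¬Ru Rv)
  crossing-edge R? (_∷_ {y = w} e p) ¬Ru Rv with R? w
  ... | yes Rw = _ , w , e , here refl , there (start∈ʷ p) , ¬Ru , Rw
  ... | no ¬Rw with a , b , ab , a∈ , b∈ , ¬Ra , Rb ← crossing-edge R? p ¬Rw Rv
    = a , b , ab , there a∈ , there b∈ , ¬Ra , Rb

module _ (X : Graph) where

  private variable u v : Fin (n X)

  walk? : {R : Fin (n X) → Set} → Decidable R → ∀ k u v →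
          Dec (Σ (Walk X u v) λ p → walkLength X p ≡ k × AllVertices R p)
  walk? R? zero u v with u ≟ᶠ v | R? u
  ... | yes refl | yes Ru  = yes ([] , refl , λ { _ (here refl) → Ru })
  ... | yes refl | no ¬Ru  = no λ { ([] , _ , Rp) → ¬Ru (Rp u (here refl)) }
  ... | no u≢v   | _       = no λ { ([] , _ , _) → u≢v refl }
  walk? R? (suc k) u v with R? u | any? (λ w → adj? X u w ×-dec walk? R? k w v)
  ... | yes Ru | yes (w , e , p , len , Rp) =
        yes (e ∷ p , cong suc len , λ { _ (here refl) → Ru ; z (there t) → Rp z t })
  ... | no ¬Ru | _ = no λ { ([] , () , _) ; (_ ∷ _ , _ , Rp) → ¬Ru (Rp u (here refl)) }
  ... | yes _  | no ∄ = no λ { ([] , () , _)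
                             ; (_∷_ {y = w} e p , len , Rp) →
                                 ∄ (w , e , p , suc-injective len , λ z t → Rp z (there t)) }

  shortest-walk : Walk X u v → Σ (Walk X u v) (IsShortest X)
  shortest-walk {u} {v} p =
    let _ , (p₀ , len₀ , _) , minimal = least (λ k → walk? U? k u v) (p , refl , λ _ _ → tt)
    in p₀ , λ q → subst (_≤ walkLength X q) (sym len₀) (minimal (q , refl , λ _ _ → tt))

  Visible : Subset (n X) → Fin (n X) → Fin (n X) → Set
  Visible S x y = Σ (Walk X x y) λ p → IsShortest X p × Unblocked S p

  -- A walk is shortest iff it is as long as one fixed shortest walk p₀.
  visible? : (∀ x y → Walk X x y) → ∀ S x y → Dec (Visible S x y)
  visible? walk S x y =
    let p₀ , p₀-shortest = shortest-walk (walk x y)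
    in map′ (λ (p , len , unblocked) →
               p , (λ q → subst (_≤ walkLength X q) (sym len) (p₀-shortest q)) , unblocked)
            (λ (p , p-shortest , unblocked) →
               p , ≤-antisym (p-shortest p₀) (p₀-shortest p) , unblocked)
            (walk? (λ z → z ∈? S →-dec z ≟ᶠ y) (walkLength X p₀) x y)

  isVisibilitySet? : (∀ x y → Walk X x y) → ∀ x S → Dec (IsVisibilitySet X x S)
  isVisibilitySet? walk x S = ¬? (x ∈? S) ×-dec all? (λ y → y ∈? S →-dec visible? walk S x y)

  vv-exists : Connected X → ∃[ k ] IsVV X k
  vv-exists (1≤n , walk) =
    let k , attained , maximal = greatest
          (λ j → any? λ x → anySubset? λ S → isVisibilitySet? walk x S ×-dec ∣ S ∣ ≟ j)
          (fromℕ< 1≤n , ⊥ , (∉⊥ , λ _ y∈⊥ → ⊥-elim (∉⊥ y∈⊥)) , ∣⊥∣≡0 (n X))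
          (λ { (_ , S , _ , refl) → ∣p∣≤n S })
    in k , attained , λ x S vis → maximal (x , S , vis , refl)

module Product (G H : Graph) where

  P : Graph
  P = G □ H

  π₁ : Fin (n P) → Fin (n G)
  π₁ i = proj₁ (remQuot {n G} (n H) i)

  π₂ : Fin (n P) → Fin (n H)
  π₂ i = proj₂ (remQuot {n G} (n H) i)

  π₁-combine : ∀ g h → π₁ (combine g h) ≡ g
  π₁-combine g h = cong proj₁ (remQuot-combine {n G} {n H} g h)

  π₂-combine : ∀ g h → π₂ (combine g h) ≡ h
  π₂-combine g h = cong proj₂ (remQuot-combine {n G} {n H} g h)

  combine-π : ∀ i → combine (π₁ i) (π₂ i) ≡ i
  combine-π = combine-remQuot {n G} (n H)

  private variable
    a b : Fin (n G)
    c d : Fin (n H)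
    i j z : Fin (n P)

  edge₁ : ∀ h → Adj G a b → Adj P (combine a h) (combine b h)
  edge₁ {a} {b} h e = inj₁ ( subst₂ (Adj G) (sym (π₁-combine a h)) (sym (π₁-combine b h)) e
                           , trans (π₂-combine a h) (sym (π₂-combine b h)))

  edge₂ : ∀ g → Adj H c d → Adj P (combine g c) (combine g d)
  edge₂ {c} {d} g e = inj₂ ( trans (π₁-combine g c) (sym (π₁-combine g d))
                           , subst₂ (Adj H) (sym (π₂-combine g c)) (sym (π₂-combine g d)) e)

  lift₁ : ∀ h → Walk G a b → Walk P (combine a h) (combine b h)
  lift₁ h []      = []
  lift₁ h (e ∷ w) = edge₁ h e ∷ lift₁ h w

  lift₂ : ∀ g → Walk H c d → Walk P (combine g c) (combine g d)
  lift₂ g []      = []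
  lift₂ g (e ∷ w) = edge₂ g e ∷ lift₂ g w

  length-lift₁ : ∀ h (w : Walk G a b) → walkLength P (lift₁ h w) ≡ walkLength G w
  length-lift₁ h []      = refl
  length-lift₁ h (e ∷ w) = cong suc (length-lift₁ h w)

  length-lift₂ : ∀ g (w : Walk H c d) → walkLength P (lift₂ g w) ≡ walkLength H w
  length-lift₂ g []      = refl
  length-lift₂ g (e ∷ w) = cong suc (length-lift₂ g w)

  π₂-lift₁ : ∀ h (w : Walk G a b) → z ∈ʷ lift₁ h w → π₂ z ≡ h
  π₂-lift₁ {a} h []      (here refl) = π₂-combine a h
  π₂-lift₁ {a} h (e ∷ w) (here refl) = π₂-combine a h
  π₂-lift₁     h (e ∷ w) (there t)   = π₂-lift₁ h w t

  π₁-lift₂ : ∀ g (w : Walk H c d) → z ∈ʷ lift₂ g w → π₁ z ≡ g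
  π₁-lift₂ {c} g []      (here refl) = π₁-combine g c
  π₁-lift₂ {c} g (e ∷ w) (here refl) = π₁-combine g c
  π₁-lift₂     g (e ∷ w) (there t)   = π₁-lift₂ g w t

  project₁ : Walk P i j → Walk G (π₁ i) (π₁ j)
  project₁ []                 = []
  project₁ (inj₁ (e , _) ∷ W) = e ∷ project₁ W
  project₁ (inj₂ (r , _) ∷ W) = cast (sym r) refl (project₁ W)

  project₂ : Walk P i j → Walk H (π₂ i) (π₂ j)
  project₂ []                 = []
  project₂ (inj₁ (_ , r) ∷ W) = cast (sym r) refl (project₂ W)
  project₂ (inj₂ (_ , e) ∷ W) = e ∷ project₂ W

  length-project : (W : Walk P i j) →
                   walkLength G (project₁ W) + walkLength H (project₂ W) ≡ walkLength P W
  length-project [] = refl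
  length-project (inj₁ (e , r) ∷ W) =
    cong suc (trans (cong (walkLength G (project₁ W) +_) (length-cast (sym r) refl (project₂ W)))
                    (length-project W))
  length-project (inj₂ (r , e) ∷ W) = begin
    walkLength G (cast (sym r) refl (project₁ W)) + suc (walkLength H (project₂ W))
      ≡⟨ cong (_+ _) (length-cast (sym r) refl (project₁ W)) ⟩
    walkLength G (project₁ W) + suc (walkLength H (project₂ W))
      ≡⟨ +-suc _ _ ⟩
    suc (walkLength G (project₁ W) + walkLength H (project₂ W))
      ≡⟨ cong suc (length-project W) ⟩
    suc (walkLength P W) ∎
    where open ≡-Reasoning

  shortest-by-projections : ∀ {d₁ d₂} (w : Walk P i j) →
    (∀ W → d₁ ≤ walkLength G (project₁ W)) → (∀ W → d₂ ≤ walkLength H (project₂ W)) →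
    walkLength P w ≡ d₁ + d₂ → IsShortest P w
  shortest-by-projections w d₁≤ d₂≤ len W =
    subst₂ _≤_ (sym len) (length-project W) (+-mono-≤ (d₁≤ W) (d₂≤ W))

  connected : Connected G → Connected H → Connected P
  connected (1≤nG , walkG) (1≤nH , walkH) = *-mono-≤ 1≤nG 1≤nH , λ i j →
    cast (combine-π i) (combine-π j)
         (lift₁ (π₂ i) (walkG (π₁ i) (π₁ j)) ++ʷ lift₂ (π₁ j) (walkH (π₂ i) (π₂ j)))

  N₁ : Fin (n P) → Subset (n P)
  N₁ x = subset (λ y → adj? G (π₁ x) (π₁ y))

  N₂ : Fin (n P) → Subset (n P)
  N₂ x = subset (λ y → adj? H (π₂ x) (π₂ y))

  ∈N₁⁺ : ∀ {x} → Adj G (π₁ x) (π₁ z) → z ∈ N₁ x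
  ∈N₁⁺ {x = x} = ∈-subset⁺ (λ y → adj? G (π₁ x) (π₁ y))

  ∈N₁⁻ : ∀ {x} → z ∈ N₁ x → Adj G (π₁ x) (π₁ z)
  ∈N₁⁻ {x = x} = ∈-subset⁻ (λ y → adj? G (π₁ x) (π₁ y))

  ∈N₂⁺ : ∀ {x} → Adj H (π₂ x) (π₂ z) → z ∈ N₂ x
  ∈N₂⁺ {x = x} = ∈-subset⁺ (λ y → adj? H (π₂ x) (π₂ y))

  ∈N₂⁻ : ∀ {x} → z ∈ N₂ x → Adj H (π₂ x) (π₂ z)
  ∈N₂⁻ {x = x} = ∈-subset⁻ (λ y → adj? H (π₂ x) (π₂ y))

  N₁-visibility : Connected H → ∀ x → IsVisibilitySet P x (N₁ x)
  N₁-visibility (_ , walkH) x = ∉N₁ refl , visible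
    where
    ∉N₁ : π₁ z ≡ π₁ x → z ∉ N₁ x
    ∉N₁ r z∈ = irrefl G (subst (Adj G (π₁ x)) r (∈N₁⁻ z∈))

    visible : ∀ y → y ∈ N₁ x → Visible P (N₁ x) x y
    visible y y∈ = path , shortest , unblocked
      where
      e : Adj G (π₁ x) (π₁ y)
      e = ∈N₁⁻ y∈

      Q : Walk H (π₂ x) (π₂ y)
      Q = proj₁ (shortest-walk H (walkH (π₂ x) (π₂ y)))

      along : Walk P (combine (π₁ x) (π₂ x)) (combine (π₁ y) (π₂ y))
      along = lift₂ (π₁ x) Q ++ʷ edge₁ (π₂ y) e ∷ []

      path : Walk P x y
      path = cast (combine-π x) (combine-π y) along

      length-path : walkLength P path ≡ 1 + walkLength H Q
      length-path = begin
        walkLength P path                       ≡⟨ length-cast (combine-π x) (combine-π y) along ⟩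
        walkLength P along                      ≡⟨ length-++ʷ (lift₂ (π₁ x) Q) _ ⟩
        walkLength P (lift₂ (π₁ x) Q) + 1       ≡⟨ cong (_+ 1) (length-lift₂ (π₁ x) Q) ⟩
        walkLength H Q + 1                      ≡⟨ +-comm (walkLength H Q) 1 ⟩
        1 + walkLength H Q                      ∎
        where open ≡-Reasoning

      shortest : IsShortest P path
      shortest = shortest-by-projections path
        (λ W → ≢⇒1≤length (λ r → irrefl G (subst (Adj G (π₁ x)) (sym r) e)) (project₁ W))
        (λ W → proj₂ (shortest-walk H (walkH (π₂ x) (π₂ y))) (project₂ W))
        length-path

      unblocked : Unblocked (N₁ x) path
      unblocked z z∈path z∈N
        with ∈ʷ-++⁻ (lift₂ (π₁ x) Q) _ (∈ʷ-cast⁻ (combine-π x) (combine-π y) along z∈path)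
      ... | inj₁ z∈Q               = ⊥-elim (∉N₁ (π₁-lift₂ (π₁ x) Q z∈Q) z∈N)
      ... | inj₂ (here refl)         = ⊥-elim (∉N₁ (π₁-combine (π₁ x) (π₂ y)) z∈N)
      ... | inj₂ (there (here refl)) = combine-π y

  N₂-visibility : Connected G → ∀ x → IsVisibilitySet P x (N₂ x)
  N₂-visibility (_ , walkG) x = ∉N₂ refl , visible
    where
    ∉N₂ : π₂ z ≡ π₂ x → z ∉ N₂ x
    ∉N₂ r z∈ = irrefl H (subst (Adj H (π₂ x)) r (∈N₂⁻ z∈))

    visible : ∀ y → y ∈ N₂ x → Visible P (N₂ x) x y
    visible y y∈ = path , shortest , unblocked
      where
      e : Adj H (π₂ x) (π₂ y)
      e = ∈N₂⁻ y∈

      Q : Walk G (π₁ x) (π₁ y)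
      Q = proj₁ (shortest-walk G (walkG (π₁ x) (π₁ y)))

      along : Walk P (combine (π₁ x) (π₂ x)) (combine (π₁ y) (π₂ y))
      along = lift₁ (π₂ x) Q ++ʷ edge₂ (π₁ y) e ∷ []

      path : Walk P x y
      path = cast (combine-π x) (combine-π y) along

      length-path : walkLength P path ≡ walkLength G Q + 1
      length-path = begin
        walkLength P path                       ≡⟨ length-cast (combine-π x) (combine-π y) along ⟩
        walkLength P along                      ≡⟨ length-++ʷ (lift₁ (π₂ x) Q) _ ⟩
        walkLength P (lift₁ (π₂ x) Q) + 1       ≡⟨ cong (_+ 1) (length-lift₁ (π₂ x) Q) ⟩
        walkLength G Q + 1                      ∎
        where open ≡-Reasoning

      shortest : IsShortest P path
      shortest = shortest-by-projections path
        (λ W → proj₂ (shortest-walk G (walkG (π₁ x) (π₁ y))) (project₁ W))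
        (λ W → ≢⇒1≤length (λ r → irrefl H (subst (Adj H (π₂ x)) (sym r) e)) (project₂ W))
        length-path

      unblocked : Unblocked (N₂ x) path
      unblocked z z∈path z∈N
        with ∈ʷ-++⁻ (lift₁ (π₂ x) Q) _ (∈ʷ-cast⁻ (combine-π x) (combine-π y) along z∈path)
      ... | inj₁ z∈Q               = ⊥-elim (∉N₂ (π₂-lift₁ (π₂ x) Q z∈Q) z∈N)
      ... | inj₂ (here refl)         = ⊥-elim (∉N₂ (π₂-combine (π₁ y) (π₂ x)) z∈N)
      ... | inj₂ (there (here refl)) = combine-π y

  degree*n≤∣N₁∣ : ∀ x → degree G (π₁ x) * n H ≤ ∣ N₁ x ∣
  degree*n≤∣N₁∣ x = ↣⇒≤∣p∣ (combine-↣ (neighbour G (π₁ x)) (↣-id (Fin (n H)))) λ i →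
    ∈N₁⁺ (subst (Adj G (π₁ x)) (sym (π₁-combine _ _)) (neighbour-adjacent G (π₁ x) _))

  n*degree≤∣N₂∣ : ∀ x → n G * degree H (π₂ x) ≤ ∣ N₂ x ∣
  n*degree≤∣N₂∣ x = ↣⇒≤∣p∣ (combine-↣ (↣-id (Fin (n G))) (neighbour H (π₂ x))) λ i →
    ∈N₂⁺ (subst (Adj H (π₂ x)) (sym (π₂-combine _ _)) (neighbour-adjacent H (π₂ x) _))

  Δ₁*n₂≤vv : Connected H → ∀ {k} → IsVV P k → Δ G * n H ≤ k
  Δ₁*n₂≤vv cH@(1≤nH , _) (_ , maximal) with Δ-attained G
  ... | inj₁ Δ≡0 rewrite Δ≡0 = z≤n
  ... | inj₂ (g , Δ≡deg) rewrite Δ≡deg =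
    let x = combine g (fromℕ< 1≤nH) in
    ≤-trans (subst (λ g′ → degree G g′ * n H ≤ ∣ N₁ x ∣) (π₁-combine g _) (degree*n≤∣N₁∣ x))
            (maximal x (N₁ x) (N₁-visibility cH x))

  Δ₂*n₁≤vv : Connected G → ∀ {k} → IsVV P k → Δ H * n G ≤ k
  Δ₂*n₁≤vv cG@(1≤nG , _) (_ , maximal) with Δ-attained H
  ... | inj₁ Δ≡0 rewrite Δ≡0 = z≤n
  ... | inj₂ (h , Δ≡deg) rewrite Δ≡deg =
    let x = combine (fromℕ< 1≤nG) h in
    ≤-trans (subst (λ h′ → degree H h′ * n G ≤ ∣ N₂ x ∣) (π₂-combine _ h)
                   (subst (_≤ ∣ N₂ x ∣) (*-comm (n G) _) (n*degree≤∣N₂∣ x)))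
            (maximal x (N₂ x) (N₂-visibility cG x))

  π₂-changes⇒π₁-fixed : Adj P i j → π₂ i ≢ π₂ j → π₁ i ≡ π₁ j
  π₂-changes⇒π₁-fixed (inj₁ (_ , r)) π₂i≢π₂j = ⊥-elim (π₂i≢π₂j r)
  π₂-changes⇒π₁-fixed (inj₂ (r , _)) _       = r

  row-member : ∀ {S h} → (∀ g → combine g h ∈ S) → π₂ z ≡ h → z ∈ S
  row-member {z} {S} row⊆S r =
    subst (_∈ S) (trans (cong (combine (π₁ z)) (sym r)) (combine-π z)) (row⊆S (π₁ z))

  column-escapes : ∀ {x S h} → IsVisibilitySet P x S → (∀ g → combine g h ∈ S) →
                   ∀ g → ∃[ a ] π₁ a ≡ g × a ∉ S
  column-escapes {x} {S} {h} (x∉S , visible) row⊆S g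
    with p , _ , unblocked ← visible (combine g h) (row⊆S g)
    with a , b , ab , a∈p , b∈p , π₂a≢h , π₂b≡h
           ← crossing-edge (λ z → π₂ z ≟ᶠ h) p (λ r → x∉S (row-member row⊆S r)) (π₂-combine g h)
    = a , π₁a≡g , a∉S
    where
    b≡y : b ≡ combine g h
    b≡y = unblocked b b∈p (row-member row⊆S π₂b≡h)

    π₁a≡g : π₁ a ≡ g
    π₁a≡g = trans (π₂-changes⇒π₁-fixed ab (λ r → π₂a≢h (trans r π₂b≡h)))
                  (trans (cong π₁ b≡y) (π₁-combine g h))

    a∉S : a ∉ S
    a∉S a∈S = π₂a≢h (trans (cong π₂ (unblocked a a∈p a∈S)) (π₂-combine g h))

  n₂≤∣∁S∣ : n H ≤ n G → ∀ {x S} → IsVisibilitySet P x S → n H ≤ ∣ ∁ S ∣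
  n₂≤∣∁S∣ nH≤nG {x} {S} vis with any? (λ h → all? (λ g → combine g h ∈? S))
  ... | yes (h , row⊆S) =
    let escape = column-escapes vis row⊆S in
    ≤-trans nH≤nG (left-inverse⇒≤∣p∣ (proj₁ ∘ escape) π₁ (proj₁ ∘ proj₂ ∘ escape)
                                     (x∉p⇒x∈∁p ∘ proj₂ ∘ proj₂ ∘ escape))
  ... | no ¬row⊆S =
    let escape h = ¬∀⟶∃¬ (n G) _ (λ g → combine g h ∈? S) (λ row⊆S → ¬row⊆S (h , row⊆S)) in
    left-inverse⇒≤∣p∣ (λ h → combine (proj₁ (escape h)) h) π₂ (λ h → π₂-combine _ h)
                      (x∉p⇒x∈∁p ∘ proj₂ ∘ escape)

  ∣S∣≤[n₁∸1]*n₂ : n H ≤ n G → ∀ {x S} → IsVisibilitySet P x S → ∣ S ∣ ≤ (n G ∸ 1) * n H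
  ∣S∣≤[n₁∸1]*n₂ nH≤nG {S = S} vis =
    subst (∣ S ∣ ≤_) (sym ([m∸1]*n≡m*n∸n (n G) (n H))) (≤∣∁p∣⇒∣p∣≤n∸ S (n₂≤∣∁S∣ nH≤nG vis))

length-filter-≢ : ∀ {m} (v : Fin m) {xs : List (Fin m)} → Unique xs →
                  length xs ∸ 1 ≤ length (filter (λ u → ¬? (v ≟ᶠ u)) xs)
length-filter-≢ v {[]}     []          = z≤n
length-filter-≢ v {x ∷ xs} (x∉xs ∷ xs-unique) with v ≟ᶠ x
... | yes refl = ≤-reflexive (sym (cong length (filter-all (λ u → ¬? (v ≟ᶠ u)) x∉xs)))
... | no v≢x   = ≤-trans (m≤n+m∸n (length xs) 1) (s≤s (length-filter-≢ v xs-unique))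

K-degree : ∀ m (v : Fin m) → m ∸ 1 ≤ degree (K m) v
K-degree m v =
  subst (λ l → l ∸ 1 ≤ degree (K m) v) (length-tabulate {n = m} id) (length-filter-≢ v (allFin⁺ m))

K-connected : ∀ {m} → 1 ≤ m → Connected (K m)
K-connected 1≤m = 1≤m , walk
  where
  walk : ∀ x y → Walk (K _) x y
  walk x y with x ≟ᶠ y
  ... | yes refl = []
  ... | no x≢y   = x≢y ∷ []

vv-□-bounds : ∀ (G H : Graph) → Connected G → Connected H → n H ≤ n G →
              ∃[ k ] (IsVV (G □ H) k × (Δ G * n H) ⊔ (Δ H * n G) ≤ k × k ≤ (n G ∸ 1) * n H)
vv-□-bounds G H cG cH nH≤nG =
  let open Product G H
      k , vv = vv-exists P (connected cG cH)
      _ , _ , vis , ∣S∣≡k = proj₁ vv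
  in k , vv , ⊔-lub (Δ₁*n₂≤vv cH vv) (Δ₂*n₁≤vv cG vv)
       , subst (_≤ (n G ∸ 1) * n H) ∣S∣≡k (∣S∣≤[n₁∸1]*n₂ nH≤nG vis)

vv-K□K : ∀ (m n : ℕ) → 2 ≤ n → n ≤ m → IsVV (K m □ K n) (m * n ∸ n)
vv-K□K m n 2≤n n≤m = (x , N₁ x , visibility , ≤-antisym (upper visibility) lower) , λ _ _ → upper
  where
  open Product (K m) (K n)

  Kn-connected : Connected (K n)
  Kn-connected = K-connected (≤-trans (s≤s z≤n) 2≤n)

  x : Fin (m * n)
  x = fromℕ< (proj₁ (connected (K-connected (≤-trans (s≤s z≤n) (≤-trans 2≤n n≤m))) Kn-connected))

  visibility : IsVisibilitySet P x (N₁ x)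
  visibility = N₁-visibility Kn-connected x

  upper : ∀ {y S} → IsVisibilitySet P y S → ∣ S ∣ ≤ m * n ∸ n
  upper {S = S} vis = subst (∣ S ∣ ≤_) ([m∸1]*n≡m*n∸n m n) (∣S∣≤[n₁∸1]*n₂ n≤m vis)

  lower : m * n ∸ n ≤ ∣ N₁ x ∣
  lower = subst (_≤ ∣ N₁ x ∣) ([m∸1]*n≡m*n∸n m n)
                (≤-trans (*-monoˡ-≤ n (K-degree m (π₁ x))) (degree*n≤∣N₁∣ x))

proposition4p1 : (∀ (G H : Graph) → Connected G → Connected H → n H ≤ n G →
    ∃[ k ] (IsVV (G □ H) k
            × ((Δ G * n H) ⊔ (Δ H * n G) ≤ k)
            × k ≤ (n G ∸ 1) * n H))
  × (∀ (m n : ℕ) → 2 ≤ n → n ≤ m → IsVV (K m □ K n) (m * n ∸ n))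
proposition4p1 = vv-□-bounds , vv-K□K
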